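{- Let $m>n$ and let $t$ be an integer with $0\le t<\log n$. For every $t$-bit restriction $\rho$ to $\mathrm{BinPHP}^m_n$, there is no Resolution refutation of $\mathrm{BinPHP}^m_n\!\upharpoonright_\rho$ of size smaller than $e^{\frac{n}{4^{2}\cdot 2^t(\log n-t)}}$.
   Context: $n$ is a power of 2; for a hole $a\in[n]$, $a_1\dots a_{\log n}$ is its binary representation; $\omega^1=\omega$, $\omega^0=\neg\omega$. $\mathrm{BinPHP}^m_n$ has variables $\omega_{i,\ell}$ ($i\in[m]$ pigeons, $\ell\in[\log n]$) and, for all $i\neq i'\in[m]$ and $a\in[n]$, the clause $\bigvee_{\ell}\omega_{i,\ell}^{1-a_\ell}\vee\bigvee_\ell\omega_{i',\ell}^{1-a_\ell}$. A $t$-bit restriction is a partial assignment assigning exactly $t$ of the variables $\omega_{i,1},\dots,\omega_{i,\log n}$ for each pigeon $i$; $F\!\upharpoonright_\rho$ is $F$ simplified under $\rho$. Size of a refutation is the number of inference steps. (This is the property $\mathrm{PHP}(1,t)$: in general $\mathrm{PHP}(s,t)$ states that for every $t$-bit $\rho$ there is no $\mathrm{Res}(s)$ refutation of $\mathrm{BinPHP}^m_n\!\upharpoonright_\rho$ of size smaller than $e^{n/(4^{\xi(s)+1}s!\,2^t u^{\xi(s)})}$ with $u=\log n-t$, $\xi(1)=1$.) -}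

module Defs where

open import Data.Nat using (ℕ; zero; suc; _+_; _*_; _^_; _<_; _!)
open import Data.Fin using (Fin)
open import Data.Bool using (Bool; not)
open import Data.Maybe using (Maybe; just; nothing; is-just)
open import Data.Product using (_×_; _,_; proj₁; ∃; ∃-syntax)
open import Data.Sum using (_⊎_)
open import Data.List using (List; []; _∷_; map; _++_; allFin; length; filterᵇ)
open import Data.List.Membership.Propositional using (_∈_)
open import Relation.Binary.PropositionalEquality using (_≡_; _≢_)
open import Relation.Nullary using (¬_)
open import Function.Bundles using (_⇔_)

-- Variable ω_{i,ℓ} is the pair (i , ℓ) with i : Fin m, ℓ : Fin k (k = log n).
-- A literal (v , true) is ω_v, a literal (v , false) is ¬ ω_v.
-- A clause is a list of literals, read as the set of its literals.

Var : ℕ → ℕ → Set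
Var m k = Fin m × Fin k

Literal : ℕ → ℕ → Set
Literal m k = Var m k × Bool

Clause : ℕ → ℕ → Set
Clause m k = List (Literal m k)

-- a hole a ∈ [n] is given by its binary representation a₁ … a_k
Hole : ℕ → Set
Hole k = Fin k → Bool

-- ⋁_ℓ ω_{i,ℓ}^{1-a_ℓ}  (ω^1 = ω, ω^0 = ¬ω, so ω^{1-a_ℓ} has polarity not a_ℓ)
pigeonPart : ∀ {m} k → Fin m → Hole k → Clause m k
pigeonPart k i a = map (λ ℓ → ((i , ℓ) , not (a ℓ))) (allFin k)

binPHPClause : ∀ {m} k → Fin m → Fin m → Hole k → Clause m k
binPHPClause k i i' a = pigeonPart k i a ++ pigeonPart k i' a

PartialAssignment : ℕ → ℕ → Set
PartialAssignment m k = Fin m → Fin k → Maybe Bool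

assigned : ∀ {m k} → PartialAssignment m k → Var m k → Maybe Bool
assigned ρ (i , ℓ) = ρ i ℓ

IsTBitRestriction : ∀ {m k} → ℕ → PartialAssignment m k → Set
IsTBitRestriction {m} {k} t ρ =
  ∀ (i : Fin m) → length (filterᵇ (λ ℓ → is-just (ρ i ℓ)) (allFin k)) ≡ t

-- Clause C (as a set of literals) is a clause of BinPHP^m_n ↾ ρ:
-- it comes from some BinPHP clause not satisfied by ρ, with all
-- literals falsified by ρ removed (equivalently: the unassigned literals kept).
RestrictedBinPHPClause : ∀ {m k} → PartialAssignment m k → Clause m k → Set
RestrictedBinPHPClause {m} {k} ρ C =
  ∃[ i ] ∃[ i' ] ∃[ a ]
    (i ≢ i'
    × (∀ (l : Literal m k) → l ∈ binPHPClause k i i' a →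
         let (v , b) = l in assigned ρ v ≢ just b)
    × (∀ (l : Literal m k) →
         (l ∈ C) ⇔ (l ∈ binPHPClause k i i' a × assigned ρ (proj₁ l) ≡ nothing)))

-- Resolution (with weakening), proofs as sequences of clauses.
-- A proof is a list of clauses, most recent line first.

Axioms : ℕ → ℕ → Set₁
Axioms m k = Clause m k → Set

IsResolvent : ∀ {m k} → Clause m k → Clause m k → Clause m k → Set
IsResolvent {m} {k} C₁ C₂ E =
  ∃[ v ] ((v , Bool.true) ∈ C₁ × (v , Bool.false) ∈ C₂
    × (∀ (l : Literal m k) →
        (l ∈ E) ⇔ ((l ∈ C₁ × l ≢ (v , Bool.true)) ⊎ (l ∈ C₂ × l ≢ (v , Bool.false)))))

IsWeakening : ∀ {m k} → Clause m k → Clause m k → Set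
IsWeakening {m} {k} C E = ∀ (l : Literal m k) → l ∈ C → l ∈ E

data Derivation {m k} (Ax : Axioms m k) : List (Clause m k) → Set where
  empty  : Derivation Ax []
  axiom  : ∀ {Γ E} → Derivation Ax Γ → Ax E → Derivation Ax (E ∷ Γ)
  resolve : ∀ {Γ C₁ C₂ E} → Derivation Ax Γ → C₁ ∈ Γ → C₂ ∈ Γ →
            IsResolvent C₁ C₂ E → Derivation Ax (E ∷ Γ)
  weaken : ∀ {Γ C E} → Derivation Ax Γ → C ∈ Γ → IsWeakening C E →
           Derivation Ax (E ∷ Γ)

record Refutation {m k} (Ax : Axioms m k) : Set where
  field
    lines      : List (Clause m k)
    derivation : Derivation Ax lines
    contradiction : [] ∈ lines

size : ∀ {m k} {Ax : Axioms m k} → Refutation Ax → ℕ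
size π = length (Refutation.lines π)

-- Comparison S < e^(a/b) for naturals, b > 0, without reals.
-- expSum a j = Σ_{i ≤ j} a^i · j!/i!, so expSum a j / j! is the j-th
-- Taylor partial sum of e^a; these increase strictly to e^a, hence
-- S^b < e^a  iff  ∃ j, S^b · j! < expSum a j,  and (b > 0)
-- S < e^(a/b) iff S^b < e^a.

expSum : ℕ → ℕ → ℕ
expSum a zero    = 1
expSum a (suc j) = suc j * expSum a j + a ^ suc j

_<exp[_/_] : ℕ → ℕ → ℕ → Set
S <exp[ a / b ] = ∃[ j ] (S ^ b * (j !) < expSum a j)

-- Let u = k − t be the number of free bits per pigeon and q = 2 u − 1. Fixing one more bit of
-- every pigeon at random (q + 1 choices each) leaves a clause with free literals on more than w
-- pigeons unsatisfied with probability at most (q / (q + 1))^w; counting all choices, a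
-- refutation with fewer than (1 + 1/q)^w lines has a restriction satisfying all its wide lines.
-- In the restricted refutation every line C is entailed by the injectivity of at most w pigeons:
-- axioms need two, a resolvent the union of its premises' pigeons, and a pigeon not mentioned by
-- C can be dropped because, having u − 1 free bits with 2 w ≤ 2 ^ (u − 1), it can always be moved
-- to a hole avoiding the others. Wide lines are satisfied, so the empty clause would be entailed
-- by no pigeon at all, which is absurd. With w = 2 ^ (u − 2), (1 + 1/q)^(q + 1) ≥ 2 and e ≤ 4
-- turn the count into the stated bound; for u ≤ 2 that bound is below 2, while every refutation
-- has at least two lines.

module Submission where

open import Defs
open import Data.Nat
open import Data.Nat.Properties
open import Data.Nat.Tactic.RingSolver using (solve-∀)
open import Algebra.Properties.CommutativeSemigroup *-commutativeSemigroup using (x∙yz≈y∙xz)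
open import Relation.Binary.PropositionalEquality
  using (_≡_; _≢_; refl; sym; trans; cong; cong₂; subst; _≗_; module ≡-Reasoning)
open import Function using (id; _∘_; _$_; const)
open import Relation.Nullary using (¬_; Dec; yes; no; does; contradiction; ¬?)
open import Relation.Nullary.Decidable using (T?; dec-true; _×-dec_; decidable-stable)
open import Relation.Unary using (Decidable)
open import Data.Empty using (⊥; ⊥-elim)
open import Function.Bundles using (Equivalence)
open import Data.Product using (_,_; _×_; ∃-syntax; proj₁; proj₂)
open import Data.Sum using (inj₁; inj₂)
import Data.Product.Properties as Productₚ
open import Data.Bool using (Bool; true; false; not; if_then_else_; T)
import Data.Bool.Properties as Boolₚ
open import Data.Maybe using (just; nothing; fromMaybe; is-just; is-nothing)
import Data.Maybe.Properties as Maybeₚ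
open import Data.Fin using (Fin; zero; suc)
import Data.Fin.Properties as Finₚ
open import Data.Vec using ([]; _∷_; tabulate; lookup)
open import Data.Vec.Properties using (lookup⇒[]=; []=⇒lookup; lookup∘tabulate)
open import Data.Vec.Functional using (updateAt) renaming (_∷_ to _∷ᶠ_)
open import Data.Vec.Functional.Properties using (updateAt-updates; updateAt-minimal)
open import Data.Fin.Subset using (Subset; inside; outside; ⁅_⁆; _∪_; _∩_; _-_; ∣_∣)
  renaming (_∈_ to _∈ₛ_; _∉_ to _∉ₛ_; _⊆_ to _⊆ₛ_; ⊥ to ∅)
open import Data.Fin.Subset.Properties
  using ( _∈?_; x∈⁅x⁆; x∈p∩q⁺; x∈p∩q⁻; x∈p∧x≢y⇒x∈p-y; p⊆p∪q; q⊆p∪q; p─q⊆p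
        ; ∣⊥∣≡0; ∣⁅x⁆∣≡1; ∣p∩q∣≤∣q∣; x∈p⇒∣p-x∣<∣p∣; p⊆q⇒∣p∣≤∣q∣)
open import Data.List using (List; []; _∷_; length; map; _++_; concatMap; filter; filterᵇ; allFin)
open import Data.Nat.ListAction using (sum)
open import Data.List.Properties
  using (length-++; length-map; length-filter; length-tabulate; filter-++; filter-all; filter-none; filter-notAll)
open import Data.List.Membership.Propositional using (_∈_; _∉_; find; lose)
open import Data.List.Membership.Propositional.Properties
  using (∈-allFin; ∈-map⁺; ∈-map⁻; ∈-++⁺ˡ; ∈-++⁺ʳ; ∈-++⁻; ∈-concatMap⁻; ∈-filter⁺; ∈-filter⁻)
open import Data.List.Relation.Binary.Subset.Propositional.Properties using (Any-resp-⊆)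
open import Data.List.Relation.Unary.Any using (Any; here; there; any?)
import Data.List.Relation.Unary.Any as Any
open import Data.List.Relation.Unary.All using (All)
import Data.List.Relation.Unary.All as All
open import Data.List.Relation.Unary.All.Properties using (¬Any⇒All¬)
open import Data.List.Relation.Unary.Unique.Propositional using (Unique)
open import Data.List.Relation.Unary.Unique.Propositional.Properties using (allFin⁺; filter⁺)
open import Data.List.Relation.Unary.AllPairs using ([]; _∷_)

^-distribʳ-* : ∀ m n o → (m * n) ^ o ≡ m ^ o * n ^ o
^-distribʳ-* m n zero    = refl
^-distribʳ-* m n (suc o) = begin
  m * n * (m * n) ^ o     ≡⟨ cong (m * n *_) (^-distribʳ-* m n o) ⟩
  m * n * (m ^ o * n ^ o) ≡⟨ lemma m n (m ^ o) (n ^ o) ⟩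
  m * m ^ o * (n * n ^ o) ∎
  where
  open ≡-Reasoning
  lemma : ∀ m n x y → m * n * (x * y) ≡ m * x * (n * y)
  lemma = solve-∀

[1+m]^[1+n]≤m^[1+n]+[1+n]*[1+m]^n : ∀ m n → suc m ^ suc n ≤ m ^ suc n + suc n * suc m ^ n
[1+m]^[1+n]≤m^[1+n]+[1+n]*[1+m]^n m zero = ≤-reflexive (lemma m)
  where
  lemma : ∀ m → (1 + m) * 1 ≡ m * 1 + 1 * 1
  lemma = solve-∀
[1+m]^[1+n]≤m^[1+n]+[1+n]*[1+m]^n m (suc n) = begin
  suc m * suc m ^ suc n
    ≤⟨ *-monoʳ-≤ (suc m) ([1+m]^[1+n]≤m^[1+n]+[1+n]*[1+m]^n m n) ⟩
  suc m * (m ^ suc n + suc n * suc m ^ n)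
    ≡⟨ expand m (m ^ suc n) (suc m ^ n) n ⟩
  m * m ^ suc n + m ^ suc n + suc n * (suc m * suc m ^ n)
    ≤⟨ +-monoˡ-≤ _ (+-monoʳ-≤ (m * m ^ suc n) (^-monoˡ-≤ (suc n) (n≤1+n m))) ⟩
  m * m ^ suc n + suc m ^ suc n + suc n * suc m ^ suc n
    ≡⟨ collect (m * m ^ suc n) (suc m ^ suc n) n ⟩
  m * m ^ suc n + suc (suc n) * suc m ^ suc n ∎
  where
  open ≤-Reasoning
  expand : ∀ m x y n → (1 + m) * (x + (1 + n) * y) ≡ m * x + x + (1 + n) * ((1 + m) * y)
  expand = solve-∀
  collect : ∀ x y n → x + y + (1 + n) * y ≡ x + (2 + n) * y
  collect = solve-∀

-- expSumHalf x j = 2 ^ j * j ! * Σ_{i ≤ j} (x / 2) ^ i / i !, a partial sum of e^(x/2)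
expSumHalf : ℕ → ℕ → ℕ
expSumHalf x zero    = 1
expSumHalf x (suc j) = 2 * (suc j * expSumHalf x j) + x ^ suc j

expSumHalf-double : ∀ a j → expSumHalf (2 * a) j ≡ 2 ^ j * expSum a j
expSumHalf-double a zero    = refl
expSumHalf-double a (suc j)
  rewrite expSumHalf-double a j | ^-distribʳ-* 2 a (suc j) = lemma (2 ^ j) (expSum a j) (a ^ suc j) j
  where
  lemma : ∀ p e x j → 2 * (suc j * (p * e)) + 2 * p * x ≡ 2 * p * (suc j * e + x)
  lemma = solve-∀

expSumHalf-zero : ∀ j → expSumHalf 0 j ≡ 2 ^ j * j !
expSumHalf-zero zero    = refl
expSumHalf-zero (suc j) rewrite expSumHalf-zero j = lemma (2 ^ j) (j !) j
  where
  lemma : ∀ p f j → 2 * (suc j * (p * f)) + 0 ≡ 2 * p * (f + j * f)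
  lemma = solve-∀

-- The x-derivative of expSumHalf x (1 + j) is (1 + j) * expSumHalf x j, which increases with x:
-- this is the mean value inequality for the increment 1.
expSumHalf-increment : ∀ x j →
  expSumHalf (suc x) (suc j) ≤ expSumHalf x (suc j) + suc j * expSumHalf (suc x) j
expSumHalf-increment x zero = ≤-reflexive (lemma x)
  where
  lemma : ∀ x → 2 * (1 * 1) + (1 + x) * 1 ≡ 2 * (1 * 1) + x * 1 + 1 * 1
  lemma = solve-∀
expSumHalf-increment x (suc j) = begin
  2 * (J * A) + suc x ^ J
    ≤⟨ +-monoˡ-≤ (suc x ^ J) (*-monoʳ-≤ 2 (*-monoʳ-≤ J (expSumHalf-increment x j))) ⟩
  2 * (J * (B + suc j * A′)) + suc x ^ J
    ≤⟨ +-monoʳ-≤ (2 * (J * (B + suc j * A′))) ([1+m]^[1+n]≤m^[1+n]+[1+n]*[1+m]^n x (suc j)) ⟩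
  2 * (J * (B + suc j * A′)) + (x ^ J + J * suc x ^ suc j)
    ≡⟨ regroup J B (suc j) A′ (x ^ J) (suc x ^ suc j) ⟩
  (2 * (J * B) + x ^ J) + J * (2 * (suc j * A′) + suc x ^ suc j) ∎
  where
  open ≤-Reasoning
  J  = suc (suc j)
  A  = expSumHalf (suc x) (suc j)
  A′ = expSumHalf (suc x) j
  B  = expSumHalf x (suc j)
  regroup : ∀ J B j A′ p q →
    2 * (J * (B + j * A′)) + (p + J * q) ≡ (2 * (J * B) + p) + J * (2 * (j * A′) + q)
  regroup = solve-∀

-- e^((x + 1) / 2) ≤ 2 e^(x / 2), as e ≤ 4
expSumHalf-suc : ∀ x j → expSumHalf (suc x) j ≤ 2 * expSumHalf x j
expSumHalf-suc x zero    = s≤s z≤n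
expSumHalf-suc x (suc j) = +-cancelʳ-≤ A A (2 * B) (begin
  A + A                                 ≡⟨ cong (A +_) (sym (+-identityʳ A)) ⟩
  2 * A                                 ≤⟨ *-monoʳ-≤ 2 (expSumHalf-increment x j) ⟩
  2 * (B + suc j * expSumHalf (suc x) j) ≡⟨ *-distribˡ-+ 2 B _ ⟩
  2 * B + 2 * (suc j * expSumHalf (suc x) j) ≤⟨ +-monoʳ-≤ (2 * B) (m≤m+n _ _) ⟩
  2 * B + A                             ∎)
  where
  open ≤-Reasoning
  A = expSumHalf (suc x) (suc j)
  B = expSumHalf x (suc j)

expSumHalf-≤ : ∀ x j → expSumHalf x j ≤ 2 ^ x * expSumHalf 0 j
expSumHalf-≤ zero    j = ≤-reflexive (sym (+-identityʳ _))
expSumHalf-≤ (suc x) j = begin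
  expSumHalf (suc x) j       ≤⟨ expSumHalf-suc x j ⟩
  2 * expSumHalf x j         ≤⟨ *-monoʳ-≤ 2 (expSumHalf-≤ x j) ⟩
  2 * (2 ^ x * expSumHalf 0 j) ≡⟨ *-assoc 2 (2 ^ x) _ ⟨
  2 ^ suc x * expSumHalf 0 j ∎
  where open ≤-Reasoning

expSum≤4^a*j! : ∀ a j → expSum a j ≤ 4 ^ a * j !
expSum≤4^a*j! a j = *-cancelˡ-≤ (2 ^ j) {{m^n≢0 2 j}} (begin
  2 ^ j * expSum a j          ≡⟨ expSumHalf-double a j ⟨
  expSumHalf (2 * a) j        ≤⟨ expSumHalf-≤ (2 * a) j ⟩
  2 ^ (2 * a) * expSumHalf 0 j ≡⟨ cong₂ _*_ (sym (^-*-assoc 2 2 a)) (expSumHalf-zero j) ⟩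
  4 ^ a * (2 ^ j * j !)       ≡⟨ x∙yz≈y∙xz (4 ^ a) (2 ^ j) (j !) ⟩
  2 ^ j * (4 ^ a * j !)       ∎)
  where open ≤-Reasoning

<exp⇒^<4^ : ∀ {S a b} → S <exp[ a / b ] → S ^ b < 4 ^ a
<exp⇒^<4^ {S} {a} {b} (j , S^b*j!<expSum) =
  *-cancelʳ-< (j !) (S ^ b) (4 ^ a) (<-≤-trans S^b*j!<expSum (expSum≤4^a*j! a j))

2≤S⇒2a≤b⇒¬S<exp[a/b] : ∀ {S a b} → 2 ≤ S → 2 * a ≤ b → ¬ (S <exp[ a / b ])
2≤S⇒2a≤b⇒¬S<exp[a/b] {S} {a} {b} 2≤S 2a≤b S<exp = <⇒≱ (<exp⇒^<4^ {S} {a} {b} S<exp) (begin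
  4 ^ a       ≡⟨ ^-*-assoc 2 2 a ⟩
  2 ^ (2 * a) ≤⟨ ^-monoʳ-≤ 2 2a≤b ⟩
  2 ^ b       ≤⟨ ^-monoˡ-≤ b 2≤S ⟩
  S ^ b       ∎)
  where open ≤-Reasoning

n^k*[n+k]≤n*[1+n]^k : ∀ n k → n ^ k * (n + k) ≤ n * suc n ^ k
n^k*[n+k]≤n*[1+n]^k n zero    = ≤-reflexive (lemma n)
  where
  lemma : ∀ n → 1 * (n + 0) ≡ n * 1
  lemma = solve-∀
n^k*[n+k]≤n*[1+n]^k n (suc k) = begin
  n * n ^ k * (n + suc k)              ≤⟨ m≤m+n _ (n ^ k * k) ⟩
  n * n ^ k * (n + suc k) + n ^ k * k  ≡⟨ regroup n (n ^ k) k ⟩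
  n ^ k * (n + k) * suc n              ≤⟨ *-monoˡ-≤ (suc n) (n^k*[n+k]≤n*[1+n]^k n k) ⟩
  n * suc n ^ k * suc n                ≡⟨ reorder n (suc n ^ k) ⟩
  n * (suc n * suc n ^ k)              ∎
  where
  open ≤-Reasoning
  regroup : ∀ n p k → n * p * (n + suc k) + p * k ≡ p * (n + k) * suc n
  regroup = solve-∀
  reorder : ∀ n p → n * p * suc n ≡ n * (suc n * p)
  reorder = solve-∀

2*n^[1+n]≤[1+n]^[1+n] : ∀ n → 2 * n ^ suc n ≤ suc n ^ suc n
2*n^[1+n]≤[1+n]^[1+n] zero        = z≤n
2*n^[1+n]≤[1+n]^[1+n] n@(suc _) = *-cancelˡ-≤ n (begin
  n * (2 * n ^ suc n)      ≡⟨ lemma n (n ^ suc n) ⟩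
  n ^ suc n * (n + n)      ≤⟨ *-monoʳ-≤ (n ^ suc n) (+-monoʳ-≤ n (n≤1+n n)) ⟩
  n ^ suc n * (n + suc n)  ≤⟨ n^k*[n+k]≤n*[1+n]^k n (suc n) ⟩
  n * suc n ^ suc n        ∎)
  where
  open ≤-Reasoning
  lemma : ∀ n p → n * (2 * p) ≡ p * (n + n)
  lemma = solve-∀

-- Raise (1 + 1/q)^w ≤ S to the b-th power and use (1 + 1/q)^(q + 1) ≥ 2.
[1+q]^w≤S*q^w⇒4^a≤S^b : ∀ S q w a b .{{_ : NonZero q}} → w * b ≡ suc q * (2 * a) →
  suc q ^ w ≤ S * q ^ w → 4 ^ a ≤ S ^ b
[1+q]^w≤S*q^w⇒4^a≤S^b S q w a b wb≡ [1+q]^w≤ =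
  *-cancelʳ-≤ (4 ^ a) (S ^ b) (q ^ (w * b)) {{m^n≢0 q (w * b)}} (begin
  4 ^ a * q ^ (w * b)                    ≡⟨ cong₂ _*_ (^-*-assoc 2 2 a) (cong (q ^_) wb≡) ⟩
  2 ^ (2 * a) * q ^ (suc q * (2 * a))    ≡⟨ cong (2 ^ (2 * a) *_) (^-*-assoc q (suc q) (2 * a)) ⟨
  2 ^ (2 * a) * (q ^ suc q) ^ (2 * a)    ≡⟨ ^-distribʳ-* 2 (q ^ suc q) (2 * a) ⟨
  (2 * q ^ suc q) ^ (2 * a)              ≤⟨ ^-monoˡ-≤ (2 * a) (2*n^[1+n]≤[1+n]^[1+n] q) ⟩
  (suc q ^ suc q) ^ (2 * a)              ≡⟨ ^-*-assoc (suc q) (suc q) (2 * a) ⟩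
  suc q ^ (suc q * (2 * a))              ≡⟨ cong (suc q ^_) wb≡ ⟨
  suc q ^ (w * b)                        ≡⟨ ^-*-assoc (suc q) w b ⟨
  (suc q ^ w) ^ b                        ≤⟨ ^-monoˡ-≤ b [1+q]^w≤ ⟩
  (S * q ^ w) ^ b                        ≡⟨ ^-distribʳ-* S (q ^ w) b ⟩
  S ^ b * (q ^ w) ^ b                    ≡⟨ cong (S ^ b *_) (^-*-assoc q w b) ⟩
  S ^ b * q ^ (w * b)                    ∎)
  where open ≤-Reasoning

<exp⇒S*q^w<[1+q]^w : ∀ {S a b} q w .{{_ : NonZero q}} → w * b ≡ suc q * (2 * a) →
  S <exp[ a / b ] → S * q ^ w < suc q ^ w
<exp⇒S*q^w<[1+q]^w {S} {a} {b} q w wb≡ S<exp with S * q ^ w <? suc q ^ w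
... | yes lt = lt
... | no ≮  = contradiction ([1+q]^w≤S*q^w⇒4^a≤S^b S q w a b wb≡ (≮⇒≥ ≮)) (<⇒≱ (<exp⇒^<4^ {S} {a} {b} S<exp))

∣p∪q∣≤∣p∣+∣q∣ : ∀ {n} (p q : Subset n) → ∣ p ∪ q ∣ ≤ ∣ p ∣ + ∣ q ∣
∣p∪q∣≤∣p∣+∣q∣ []            []            = z≤n
∣p∪q∣≤∣p∣+∣q∣ (outside ∷ p) (outside ∷ q) = ∣p∪q∣≤∣p∣+∣q∣ p q
∣p∪q∣≤∣p∣+∣q∣ (outside ∷ p) (inside ∷ q)  = ≤-trans (s≤s (∣p∪q∣≤∣p∣+∣q∣ p q)) (≤-reflexive (sym (+-suc _ _)))
∣p∪q∣≤∣p∣+∣q∣ (inside ∷ p)  (outside ∷ q) = s≤s (∣p∪q∣≤∣p∣+∣q∣ p q)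
∣p∪q∣≤∣p∣+∣q∣ (inside ∷ p)  (inside ∷ q)  = s≤s (≤-trans (∣p∪q∣≤∣p∣+∣q∣ p q) (+-monoʳ-≤ ∣ p ∣ (n≤1+n _)))

∣p∩f∣+∣p∩¬f∣≡∣p∣ : ∀ {n} (p : Subset n) (f : Fin n → Bool) →
  ∣ p ∩ tabulate f ∣ + ∣ p ∩ tabulate (not ∘ f) ∣ ≡ ∣ p ∣
∣p∩f∣+∣p∩¬f∣≡∣p∣ []      f = refl
∣p∩f∣+∣p∩¬f∣≡∣p∣ (s ∷ p) f with s | f zero | ∣p∩f∣+∣p∩¬f∣≡∣p∣ p (f ∘ suc)
... | outside | _       | eq = eq
... | inside  | true    | eq = cong suc eq
... | inside  | false   | eq = trans (+-suc _ _) (cong suc eq)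

∈-tabulate⁺ : ∀ {n} {f : Fin n → Bool} {i} → f i ≡ true → i ∈ₛ tabulate f
∈-tabulate⁺ {f = f} {i} fi≡true = lookup⇒[]= i (tabulate f) (trans (lookup∘tabulate f i) fi≡true)

∈-tabulate⁻ : ∀ {n} {f : Fin n → Bool} {i} → i ∈ₛ tabulate f → f i ≡ true
∈-tabulate⁻ {f = f} {i} i∈ = trans (sym (lookup∘tabulate f i)) ([]=⇒lookup i∈)

0<∣p∣ : ∀ {n} {p : Subset n} {i} → i ∈ₛ p → 0 < ∣ p ∣
0<∣p∣ i∈p = m<n⇒0<n (x∈p⇒∣p-x∣<∣p∣ i∈p)

≢not⇒≡ : ∀ {x y} → x ≢ not y → x ≡ y
≢not⇒≡ {x} {y} x≢not-y = trans (Boolₚ.¬-not x≢not-y) (Boolₚ.not-involutive y)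

bitIs : Bool → Bool → Bool
bitIs true  x = x
bitIs false x = not x

bitIs-refl : ∀ b → bitIs b b ≡ true
bitIs-refl true  = refl
bitIs-refl false = refl

-- Fix the first position of G to the value taken by the holes of at most half of the pigeons of S,
-- and recurse on those pigeons.
fresh-hole : ∀ {m k} (G : List (Fin k)) → Unique G → (h₀ : Hole k) (F : Fin m → Hole k) (S : Subset m) →
  ∣ S ∣ < 2 ^ length G →
  ∃[ h ] (∀ {ℓ} → ℓ ∉ G → h ℓ ≡ h₀ ℓ) × (∀ {j} → j ∈ₛ S → ¬ (h ≗ F j))
fresh-hole [] _ h₀ F S ∣S∣<1 = h₀ , (λ _ → refl) , λ j∈S _ → <⇒≱ ∣S∣<1 (0<∣p∣ j∈S)
fresh-hole {m} (g ∷ G) (g≢G ∷ G-unique) h₀ F S ∣S∣< = h , agree , distinct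
  where
  S[_] : Bool → Subset m
  S[ b ] = S ∩ tabulate (λ j → bitIs b (F j g))

  small-half : ∃[ b ] ∣ S[ b ] ∣ < 2 ^ length G
  small-half with ∣ S[ true ] ∣ <? 2 ^ length G
  ... | yes small = true , small
  ... | no  large = false , +-cancelˡ-< ∣ S[ true ] ∣ _ _ (begin-strict
    ∣ S[ true ] ∣ + ∣ S[ false ] ∣    ≡⟨ ∣p∩f∣+∣p∩¬f∣≡∣p∣ S (λ j → F j g) ⟩
    ∣ S ∣                             <⟨ ∣S∣< ⟩
    2 ^ length G + (2 ^ length G + 0) ≡⟨ cong (2 ^ length G +_) (+-identityʳ _) ⟩
    2 ^ length G + 2 ^ length G       ≤⟨ +-monoˡ-≤ _ (≮⇒≥ large) ⟩
    ∣ S[ true ] ∣ + 2 ^ length G      ∎)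
    where open ≤-Reasoning

  b = proj₁ small-half
  recursive = fresh-hole G G-unique (updateAt h₀ g (const b)) F S[ b ] (proj₂ small-half)
  h = proj₁ recursive

  g∉G : g ∉ G
  g∉G g∈G = All.lookup g≢G g∈G refl

  h[g]≡b : h g ≡ b
  h[g]≡b = trans (proj₁ (proj₂ recursive) g∉G) (updateAt-updates g h₀)

  agree : ∀ {ℓ} → ℓ ∉ g ∷ G → h ℓ ≡ h₀ ℓ
  agree ℓ∉ = trans (proj₁ (proj₂ recursive) (ℓ∉ ∘ there)) (updateAt-minimal _ g h₀ (ℓ∉ ∘ here))

  distinct : ∀ {j} → j ∈ₛ S → ¬ (h ≗ F j)
  distinct {j} j∈S with F j g Boolₚ.≟ b
  ... | yes F[g]≡b = proj₂ (proj₂ recursive)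
    (x∈p∩q⁺ (j∈S , ∈-tabulate⁺ (subst (λ x → bitIs b x ≡ true) (sym F[g]≡b) (bitIs-refl b))))
  ... | no  F[g]≢b = λ h≗F → F[g]≢b (trans (sym (h≗F g)) h[g]≡b)

∏ : ∀ {m} → (Fin m → ℕ) → ℕ
∏ {zero}  _ = 1
∏ {suc m} g = g zero * ∏ (g ∘ suc)

∏-mono-≤ : ∀ {m} {f g : Fin m → ℕ} → (∀ i → f i ≤ g i) → ∏ f ≤ ∏ g
∏-mono-≤ {zero}  f≤g = ≤-refl
∏-mono-≤ {suc m} f≤g = *-mono-≤ (f≤g zero) (∏-mono-≤ (f≤g ∘ suc))

∏-const : ∀ m c → ∏ {m} (const c) ≡ c ^ m
∏-const zero    c = refl
∏-const (suc m) c = cong (c *_) (∏-const m c)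

-- Pigeons in M have q admissible choices, the others suc q.
weight : ∀ {m} → ℕ → Subset m → Fin m → ℕ
weight q M i = if lookup M i then q else suc q

∏weight≤[1+q]^m : ∀ q {m} (M : Subset m) → ∏ (weight q M) ≤ suc q ^ m
∏weight≤[1+q]^m q {m} M = ≤-trans (∏-mono-≤ weight≤) (≤-reflexive (∏-const m (suc q)))
  where
  weight≤ : ∀ i → weight q M i ≤ suc q
  weight≤ i with lookup M i
  ... | true  = n≤1+n q
  ... | false = ≤-refl

∏weight*[1+q]^w≤q^w*[1+q]^m : ∀ q {m} (M : Subset m) w → w ≤ ∣ M ∣ →
  ∏ (weight q M) * suc q ^ w ≤ q ^ w * suc q ^ m
∏weight*[1+q]^w≤q^w*[1+q]^m q M zero _ = begin
  ∏ (weight q M) * 1 ≡⟨ *-identityʳ _ ⟩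
  ∏ (weight q M)     ≤⟨ ∏weight≤[1+q]^m q M ⟩
  _                  ≡⟨ *-identityˡ _ ⟨
  1 * _              ∎
  where open ≤-Reasoning
∏weight*[1+q]^w≤q^w*[1+q]^m q {suc m} (outside ∷ M) w w≤ = begin
  suc q * ∏ (weight q M) * suc q ^ w   ≡⟨ *-assoc (suc q) (∏ (weight q M)) (suc q ^ w) ⟩
  suc q * (∏ (weight q M) * suc q ^ w) ≤⟨ *-monoʳ-≤ (suc q) (∏weight*[1+q]^w≤q^w*[1+q]^m q M w w≤) ⟩
  suc q * (q ^ w * suc q ^ m)          ≡⟨ x∙yz≈y∙xz (suc q) (q ^ w) (suc q ^ m) ⟩
  q ^ w * suc q ^ suc m                ∎
  where open ≤-Reasoning
∏weight*[1+q]^w≤q^w*[1+q]^m q {suc m} (inside ∷ M) (suc w) (s≤s w≤) = begin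
  q * ∏ (weight q M) * (suc q * suc q ^ w)   ≡⟨ regroup q (∏ (weight q M)) (suc q) (suc q ^ w) ⟩
  q * suc q * (∏ (weight q M) * suc q ^ w)   ≤⟨ *-monoʳ-≤ (q * suc q) (∏weight*[1+q]^w≤q^w*[1+q]^m q M w w≤) ⟩
  q * suc q * (q ^ w * suc q ^ m)            ≡⟨ regroup q (suc q) (q ^ w) (suc q ^ m) ⟩
  q * q ^ w * (suc q * suc q ^ m)            ∎
  where
  open ≤-Reasoning
  regroup : ∀ a b c d → a * b * (c * d) ≡ a * c * (b * d)
  regroup = solve-∀

length-filter-map : ∀ {B C : Set} {P : C → Set} (P? : Decidable P) (h : B → C) xs →
  length (filter P? (map h xs)) ≡ length (filter (P? ∘ h) xs)
length-filter-map P? h []       = refl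
length-filter-map P? h (x ∷ xs) with does (P? (h x))
... | true  = cong suc (length-filter-map P? h xs)
... | false = length-filter-map P? h xs

module _ {A : Set} where

  length-filterᵇ-not : ∀ (p : A → Bool) xs → length (filterᵇ p xs) + length (filterᵇ (not ∘ p) xs) ≡ length xs
  length-filterᵇ-not p []       = refl
  length-filterᵇ-not p (x ∷ xs) with p x
  ... | true  = cong suc (length-filterᵇ-not p xs)
  ... | false = trans (+-suc _ _) (cong suc (length-filterᵇ-not p xs))

  sum-map-*-≤ : ∀ {f : A → ℕ} {d c} → (∀ x → f x * d ≤ c) → ∀ xs → sum (map f xs) * d ≤ length xs * c
  sum-map-*-≤ f*d≤c []       = z≤n
  sum-map-*-≤ {f} {d} f*d≤c (x ∷ xs) = begin
    (f x + sum (map f xs)) * d    ≡⟨ *-distribʳ-+ d (f x) _ ⟩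
    f x * d + sum (map f xs) * d  ≤⟨ +-mono-≤ (f*d≤c x) (sum-map-*-≤ f*d≤c xs) ⟩
    _ + length xs * _             ∎
    where open ≤-Reasoning

  length≤1+length-filter-≢ : ∀ (_≟_ : (x y : A) → Dec (x ≡ y)) {x xs} → Unique xs →
    length xs ≤ suc (length (filter (λ y → ¬? (y ≟ x)) xs))
  length≤1+length-filter-≢ _≟_ {x} {[]}     _             = z≤n
  length≤1+length-filter-≢ _≟_ {x} {y ∷ ys} (y≢ys ∷ uniq) with y ≟ x
  ... | yes refl = s≤s (≤-reflexive (cong length (sym (filter-all _ (All.map (λ y≢z z≡y → y≢z (sym z≡y)) y≢ys)))))
  ... | no  _    = s≤s (length≤1+length-filter-≢ _≟_ uniq)

  choices : ∀ {m} → (Fin m → List A) → List (Fin m → A)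
  choices {zero}  X = (λ ()) ∷ []
  choices {suc m} X = concatMap (λ x → map (x ∷ᶠ_) (choices (X ∘ suc))) (X zero)

  ∈-choices⁻ : ∀ {m} (X : Fin m → List A) {f} → f ∈ choices X → ∀ i → f i ∈ X i
  ∈-choices⁻ {suc m} X f∈ i
    with x , x∈X₀ , f∈map ← find (∈-concatMap⁻ (λ x → map (x ∷ᶠ_) (choices (X ∘ suc))) {xs = X zero} f∈)
    with f′ , f′∈ , refl ← ∈-map⁻ (x ∷ᶠ_) f∈map
    with i
  ... | zero  = x∈X₀
  ... | suc i = ∈-choices⁻ (X ∘ suc) f′∈ i

  length-choices : ∀ {m} (X : Fin m → List A) → length (choices X) ≡ ∏ (length ∘ X)
  length-choices {zero}  X = refl
  length-choices {suc m} X = go (X zero)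
    where
    go : ∀ xs → length (concatMap (λ x → map (x ∷ᶠ_) (choices (X ∘ suc))) xs) ≡ length xs * ∏ (length ∘ X ∘ suc)
    go []       = refl
    go (x ∷ xs) = begin
      length (map (x ∷ᶠ_) (choices (X ∘ suc)) ++ _)  ≡⟨ length-++ (map (x ∷ᶠ_) (choices (X ∘ suc))) ⟩
      length (map (x ∷ᶠ_) (choices (X ∘ suc))) + _
        ≡⟨ cong₂ _+_ (trans (length-map (x ∷ᶠ_) (choices (X ∘ suc))) (length-choices (X ∘ suc))) (go xs) ⟩
      ∏ (length ∘ X ∘ suc) + length xs * ∏ (length ∘ X ∘ suc) ∎
      where open ≡-Reasoning

  length-filter-choices : ∀ {m} {P : (Fin m → A) → Set} {Q : Fin m → A → Set}
    (P? : Decidable P) (Q? : ∀ i → Decidable (Q i)) → (∀ {f} → P f → ∀ i → Q i (f i)) →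
    (X : Fin m → List A) → length (filter P? (choices X)) ≤ ∏ (λ i → length (filter (Q? i) (X i)))
  length-filter-choices {zero} P? Q? _ X = length-filter P? (choices X)
  length-filter-choices {suc m} {P} {Q} P? Q? P⇒Q X = go (X zero)
    where
    L  = choices (X ∘ suc)
    ∏′ = ∏ (λ i → length (filter (Q? (suc i)) (X (suc i))))

    count-with-head : ∀ x → Q zero x → length (filter P? (map (x ∷ᶠ_) L)) ≤ ∏′
    count-with-head x _ = begin
      length (filter P? (map (x ∷ᶠ_) L))  ≡⟨ length-filter-map P? (x ∷ᶠ_) L ⟩
      length (filter (P? ∘ (x ∷ᶠ_)) L)
        ≤⟨ length-filter-choices (P? ∘ (x ∷ᶠ_)) (Q? ∘ suc) (λ Pxf → P⇒Q Pxf ∘ suc) (X ∘ suc) ⟩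
      ∏′                                  ∎
      where open ≤-Reasoning

    no-head : ∀ x → ¬ Q zero x → length (filter P? (map (x ∷ᶠ_) L)) ≡ 0
    no-head x ¬Q = cong length (filter-none P? (All.tabulate λ f∈ Pf → helper f∈ Pf))
      where
      helper : ∀ {f} → f ∈ map (x ∷ᶠ_) L → ¬ P f
      helper f∈ Pf with _ , _ , refl ← ∈-map⁻ (x ∷ᶠ_) f∈ = ¬Q (P⇒Q Pf zero)

    go : ∀ xs → length (filter P? (concatMap (λ x → map (x ∷ᶠ_) L) xs)) ≤ length (filter (Q? zero) xs) * ∏′
    go []       = z≤n
    go (x ∷ xs) rewrite filter-++ P? (map (x ∷ᶠ_) L) (concatMap (λ x → map (x ∷ᶠ_) L) xs)
                      | length-++ (filter P? (map (x ∷ᶠ_) L)) {filter P? (concatMap (λ x → map (x ∷ᶠ_) L) xs)}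
                with Q? zero x
    ... | yes Qx = +-mono-≤ (count-with-head x Qx) (go xs)
    ... | no ¬Qx rewrite no-head x ¬Qx = go xs

  union-bound : ∀ {I : Set} {B : I → A → Set} (B? : ∀ c → Decidable (B c)) (cs : List I) (L : List A) →
    sum (map (λ c → length (filter (B? c) L)) cs) < length L → ∃[ x ] x ∈ L × All (λ c → ¬ B c x) cs
  union-bound B? cs [] ()
  union-bound {I} {B} B? cs (x ∷ L) Σ< with Any.any? (λ c → B? c x) cs
  ... | no  none = x , here refl , ¬Any⇒All¬ cs none
  ... | yes some = let y , y∈L , good = union-bound B? cs L (≤-pred (≤-trans (s≤s (count-x cs some)) Σ<))
                   in y , there y∈L , good
    where
    Σ : List I → List A → ℕ
    Σ cs L = sum (map (λ c → length (filter (B? c) L)) cs)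

    count-x-mono : ∀ cs → Σ cs L ≤ Σ cs (x ∷ L)
    count-x-mono []       = z≤n
    count-x-mono (c ∷ cs) with does (B? c x)
    ... | true  = +-mono-≤ (n≤1+n _) (count-x-mono cs)
    ... | false = +-monoʳ-≤ _ (count-x-mono cs)

    count-x : ∀ cs → Any (λ c → B c x) cs → suc (Σ cs L) ≤ Σ cs (x ∷ L)
    count-x (c ∷ cs) (here Bcx) with B? c x
    ... | yes _   = s≤s (+-monoʳ-≤ _ (count-x-mono cs))
    ... | no ¬Bcx = contradiction Bcx ¬Bcx
    count-x (c ∷ cs) (there any) with does (B? c x)
    ... | true  = s≤s (+-monoʳ-≤ _ (count-x-mono cs))
    ... | false = ≤-trans (≤-reflexive (sym (+-suc (length (filter (B? c) L)) (Σ cs L))))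
                          (+-monoʳ-≤ _ (count-x cs any))

Assignment : ℕ → ℕ → Set
Assignment m k = Fin m → Hole k

module _ {m k : ℕ} where

  _⊨ˡ_ : Assignment m k → Literal m k → Set
  α ⊨ˡ ((i , ℓ) , b) = α i ℓ ≡ b

  _⊨ˡ?_ : ∀ α → Decidable (α ⊨ˡ_)
  α ⊨ˡ? ((i , ℓ) , b) = α i ℓ Boolₚ.≟ b

  _⊨_ : Assignment m k → Clause m k → Set
  α ⊨ C = Any (α ⊨ˡ_) C

  ⊨-transfer : ∀ {α β C E} → α ⊨ C → (∀ {l} → l ∈ C → α ⊨ˡ l → l ∈ E × β ⊨ˡ l) → β ⊨ E
  ⊨-transfer α⊨C move = let l , l∈C , α⊨l = find α⊨C ; l∈E , β⊨l = move l∈C α⊨l in lose l∈E β⊨l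

  ⊨ˡ-≢-negation : ∀ {α l i ℓ b} → α i ℓ ≡ b → α ⊨ˡ l → l ≢ ((i , ℓ) , not b)
  ⊨ˡ-≢-negation α[v]≡b α⊨l refl = Boolₚ.not-¬ α[v]≡b α⊨l

  _⊩ˡ_ : PartialAssignment m k → Literal m k → Set
  σ ⊩ˡ ((i , ℓ) , b) = σ i ℓ ≡ just b

  _⊩ˡ?_ : ∀ σ → Decidable (σ ⊩ˡ_)
  σ ⊩ˡ? ((i , ℓ) , b) = Maybeₚ.≡-dec Boolₚ._≟_ (σ i ℓ) (just b)

  _⊩_ : PartialAssignment m k → Clause m k → Set
  σ ⊩ C = Any (σ ⊩ˡ_) C

  _⊩?_ : ∀ σ → Decidable (σ ⊩_)
  σ ⊩? C = any? (σ ⊩ˡ?_) C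

  Extends : PartialAssignment m k → Assignment m k → Set
  Extends σ α = ∀ {i ℓ b} → σ i ℓ ≡ just b → α i ℓ ≡ b

  _⊑_ : PartialAssignment m k → PartialAssignment m k → Set
  ρ ⊑ σ = ∀ {i ℓ b} → ρ i ℓ ≡ just b → σ i ℓ ≡ just b

  ⊑-free : ∀ {ρ σ i ℓ} → ρ ⊑ σ → σ i ℓ ≡ nothing → ρ i ℓ ≡ nothing
  ⊑-free {ρ} {σ} {i} {ℓ} ρ⊑σ σ≡nothing with ρ i ℓ in ρ≡
  ... | nothing = refl
  ... | just b  = contradiction (trans (sym (ρ⊑σ ρ≡)) σ≡nothing) λ ()

  _≟ˡ_ : (l l′ : Literal m k) → Dec (l ≡ l′)
  _≟ˡ_ = Productₚ.≡-dec (Productₚ.≡-dec Finₚ._≟_ Finₚ._≟_) Boolₚ._≟_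

  freeBits : PartialAssignment m k → Fin m → List (Fin k)
  freeBits σ i = filterᵇ (is-nothing ∘ σ i) (allFin k)

  ∈-freeBits⁺ : ∀ {σ i ℓ} → σ i ℓ ≡ nothing → ℓ ∈ freeBits σ i
  ∈-freeBits⁺ {σ} {i} σ≡nothing =
    ∈-filter⁺ (T? ∘ is-nothing ∘ σ i) (∈-allFin _) (subst (T ∘ is-nothing) (sym σ≡nothing) _)

  ∈-freeBits⁻ : ∀ {σ i ℓ} → ℓ ∈ freeBits σ i → σ i ℓ ≡ nothing
  ∈-freeBits⁻ {σ} {i} {ℓ} ℓ∈ with σ i ℓ | proj₂ (∈-filter⁻ (T? ∘ is-nothing ∘ σ i) {xs = allFin k} ℓ∈)
  ... | nothing | _ = refl

  freeBits-unique : ∀ σ i → Unique (freeBits σ i)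
  freeBits-unique σ i = filter⁺ (T? ∘ is-nothing ∘ σ i) (allFin⁺ k)

  length-freeBits : ∀ {t ρ} → IsTBitRestriction t ρ → ∀ i → length (freeBits ρ i) ≡ k ∸ t
  length-freeBits {t} {ρ} t-bit i = begin
    length (freeBits ρ i)
      ≡⟨ m+n∸m≡n t _ ⟨
    t + length (freeBits ρ i) ∸ t
      ≡⟨ cong (λ x → x + length (freeBits ρ i) ∸ t) (t-bit i) ⟨
    length (filterᵇ (is-just ∘ ρ i) (allFin k)) + length (freeBits ρ i) ∸ t
      ≡⟨ cong (_∸ t) (length-filterᵇ-not (is-just ∘ ρ i) (allFin k)) ⟩
    length (allFin k) ∸ t
      ≡⟨ cong (_∸ t) (length-tabulate id) ⟩
    k ∸ t ∎
    where open ≡-Reasoning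

  _◃_ : PartialAssignment m k → (Fin m → Fin k × Bool) → PartialAssignment m k
  (ρ ◃ f) i ℓ with ℓ Finₚ.≟ proj₁ (f i)
  ... | yes _ = just (proj₂ (f i))
  ... | no  _ = ρ i ℓ

  ◃-fixes : ∀ ρ f i → (ρ ◃ f) i (proj₁ (f i)) ≡ just (proj₂ (f i))
  ◃-fixes ρ f i with proj₁ (f i) Finₚ.≟ proj₁ (f i)
  ... | yes _    = refl
  ... | no  ≢ℓ   = contradiction refl ≢ℓ

  ◃-free : ∀ {ρ f i ℓ} → ℓ ≢ proj₁ (f i) → ρ i ℓ ≡ nothing → (ρ ◃ f) i ℓ ≡ nothing
  ◃-free {ρ} {f} {i} {ℓ} ℓ≢ ρ≡nothing with ℓ Finₚ.≟ proj₁ (f i)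
  ... | yes ℓ≡ = contradiction ℓ≡ ℓ≢
  ... | no  _  = ρ≡nothing

  ⊑-◃ : ∀ {ρ f} → (∀ i → ρ i (proj₁ (f i)) ≡ nothing) → ρ ⊑ (ρ ◃ f)
  ⊑-◃ {ρ} {f} free {i} {ℓ} ρ≡ with ℓ Finₚ.≟ proj₁ (f i)
  ... | yes refl = contradiction (trans (sym ρ≡) (free i)) λ ()
  ... | no  _    = ρ≡

  OnFreeBitOf : PartialAssignment m k → Fin m → Literal m k → Set
  OnFreeBitOf σ i ((j , ℓ) , _) = j ≡ i × σ j ℓ ≡ nothing

  onFreeBitOf? : ∀ σ i → Decidable (OnFreeBitOf σ i)
  onFreeBitOf? σ i ((j , ℓ) , _) = (j Finₚ.≟ i) ×-dec Maybeₚ.≡-dec Boolₚ._≟_ (σ j ℓ) nothing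

  -- ∣ mentioned σ C ∣ is the width of C under σ
  mentioned : PartialAssignment m k → Clause m k → Subset m
  mentioned σ C = tabulate (λ i → does (any? (onFreeBitOf? σ i) C))

  ∈-mentioned⁺ : ∀ {σ C i} → Any (OnFreeBitOf σ i) C → i ∈ₛ mentioned σ C
  ∈-mentioned⁺ {σ} {C} {i} free = ∈-tabulate⁺ (dec-true (any? (onFreeBitOf? σ i) C) free)

  ∈-mentioned⁻ : ∀ {σ C i} → i ∈ₛ mentioned σ C → Any (OnFreeBitOf σ i) C
  ∈-mentioned⁻ {σ} {C} {i} i∈ with any? (onFreeBitOf? σ i) C | ∈-tabulate⁻ i∈
  ... | yes free | _ = free

  mentioned-⊑ : ∀ {ρ σ} C → ρ ⊑ σ → mentioned σ C ⊆ₛ mentioned ρ C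
  mentioned-⊑ {ρ} {σ} C ρ⊑σ i∈ = ∈-mentioned⁺ {ρ} {C} (Any.map
    (λ { {(j , ℓ) , _} (j≡i , free) → j≡i , ⊑-free {ρ} {σ} ρ⊑σ free }) (∈-mentioned⁻ {σ} {C} i∈))

module Entailment {m k} {ρ σ : PartialAssignment m k} (ρ⊑σ : ρ ⊑ σ) where

  InjectiveOn : Subset m → Assignment m k → Set
  InjectiveOn S α = ∀ {i j} → i ∈ₛ S → j ∈ₛ S → i ≢ j → ¬ (α i ≗ α j)

  Entails : Subset m → Clause m k → Set
  Entails S C = ∀ α → Extends σ α → InjectiveOn S α → α ⊨ C

  entails-⊆ : ∀ {S T C} → S ⊆ₛ T → Entails S C → Entails T C
  entails-⊆ S⊆T ⊨C α ext inj = ⊨C α ext λ i∈S j∈S → inj (S⊆T i∈S) (S⊆T j∈S)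

  ⊩⇒entails : ∀ {S C} → σ ⊩ C → Entails S C
  ⊩⇒entails σ⊩C α ext _ = Any.map (λ { {(i , ℓ) , b} → ext }) σ⊩C

  entails-weakening : ∀ {S C E} → IsWeakening C E → Entails S C → Entails S E
  entails-weakening C⊆E ⊨C α ext inj = Any-resp-⊆ (C⊆E _) (⊨C α ext inj)

  entails-resolvent : ∀ {S₁ S₂ C₁ C₂ E} → IsResolvent C₁ C₂ E →
    Entails S₁ C₁ → Entails S₂ C₂ → Entails (S₁ ∪ S₂) E
  entails-resolvent {S₁} {S₂} ((i , ℓ) , _ , _ , E⇔) ⊨C₁ ⊨C₂ α ext inj with α i ℓ in α[v]
  ... | true  = ⊨-transfer (⊨C₂ α ext λ p q → inj (q⊆p∪q S₁ S₂ p) (q⊆p∪q S₁ S₂ q))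
    λ l∈C₂ α⊨l → Equivalence.from (E⇔ _) (inj₂ (l∈C₂ , ⊨ˡ-≢-negation α[v] α⊨l)) , α⊨l
  ... | false = ⊨-transfer (⊨C₁ α ext λ p q → inj (p⊆p∪q S₂ p) (p⊆p∪q S₂ q))
    λ l∈C₁ α⊨l → Equivalence.from (E⇔ _) (inj₁ (l∈C₁ , ⊨ˡ-≢-negation α[v] α⊨l)) , α⊨l

  entails-axiom : ∀ {C} → RestrictedBinPHPClause ρ C → ∃[ S ] ∣ S ∣ ≤ 2 × Entails S C
  entails-axiom {C} (i , i′ , a , i≢i′ , unsatisfied , C⇔) = ⁅ i ⁆ ∪ ⁅ i′ ⁆ , two-pigeons , entails
    where
    two-pigeons : ∣ ⁅ i ⁆ ∪ ⁅ i′ ⁆ ∣ ≤ 2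
    two-pigeons = ≤-trans (∣p∪q∣≤∣p∣+∣q∣ ⁅ i ⁆ ⁅ i′ ⁆) (≤-reflexive (cong₂ _+_ (∣⁅x⁆∣≡1 i) (∣⁅x⁆∣≡1 i′)))

    -- an assignment falsifying C falsifies the whole BinPHP clause, so it sends i and i′ to hole a
    in-hole-a : ∀ {α} → Extends σ α → ¬ α ⊨ C →
      ∀ {p} ℓ → ((p , ℓ) , not (a ℓ)) ∈ binPHPClause k i i′ a → α p ℓ ≡ a ℓ
    in-hole-a {α} ext α⊭C {p} ℓ l∈ with ρ p ℓ in ρ≡
    ... | just b  = trans (ext (ρ⊑σ ρ≡)) (≢not⇒≡ λ b≡ → unsatisfied _ l∈ (trans ρ≡ (cong just b≡)))
    ... | nothing = ≢not⇒≡ λ α≡ → α⊭C (lose (Equivalence.from (C⇔ _) (l∈ , ρ≡)) α≡)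

    entails : Entails (⁅ i ⁆ ∪ ⁅ i′ ⁆) C
    entails α ext inj with any? (α ⊨ˡ?_) C
    ... | yes α⊨C = α⊨C
    ... | no  α⊭C = ⊥-elim (inj (p⊆p∪q ⁅ i′ ⁆ (x∈⁅x⁆ i)) (q⊆p∪q ⁅ i ⁆ ⁅ i′ ⁆ (x∈⁅x⁆ i′)) i≢i′ λ ℓ →
      trans (in-hole-a ext α⊭C ℓ (∈-++⁺ˡ (∈-map⁺ _ (∈-allFin ℓ))))
            (sym (in-hole-a ext α⊭C ℓ (∈-++⁺ʳ (pigeonPart k i a) (∈-map⁺ _ (∈-allFin ℓ))))))

  ¬entails-[] : ∀ {S} → (∀ {i} → i ∉ₛ S) → ¬ Entails S []
  ¬entails-[] S-empty ⊨[] with ⊨[] (λ i ℓ → fromMaybe false (σ i ℓ)) (λ σ≡ → cong (fromMaybe false) σ≡)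
                                  (λ i∈S → contradiction i∈S S-empty)
  ... | ()

  module _ (G : Fin m → List (Fin k)) (G-unique : ∀ i → Unique (G i))
           (G-free : ∀ {i ℓ} → ℓ ∈ G i → σ i ℓ ≡ nothing) where

    -- A pigeon not mentioned by C can be moved to a hole avoiding the other pigeons of S
    -- without affecting C.
    entails-remove : ∀ {S C i} → i ∈ₛ S → i ∉ₛ mentioned σ C → ∣ S ∣ ≤ 2 ^ length (G i) →
      Entails S C → Entails (S - i) C
    entails-remove {S} {C} {i} i∈S i∉M ∣S∣≤ ⊨C α ext inj = ⊨-transfer (⊨C α′ ext′ inj′) back
      where
      fresh = fresh-hole (G i) (G-unique i) (α i) α (S - i) (<-≤-trans (x∈p⇒∣p-x∣<∣p∣ i∈S) ∣S∣≤)
      h = proj₁ fresh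
      α′ = updateAt α i (const h)

      fixed∉G : ∀ {ℓ} → σ i ℓ ≢ nothing → ℓ ∉ G i
      fixed∉G σ≢nothing ℓ∈G = σ≢nothing (G-free ℓ∈G)

      α′-at-i : ∀ {ℓ} → σ i ℓ ≢ nothing → α′ i ℓ ≡ α i ℓ
      α′-at-i σ≢nothing = trans (cong (_$ _) (updateAt-updates i α)) (proj₁ (proj₂ fresh) (fixed∉G σ≢nothing))

      α′-elsewhere : ∀ {j} → j ≢ i → α′ j ≡ α j
      α′-elsewhere j≢i = updateAt-minimal _ i α j≢i

      ext′ : Extends σ α′
      ext′ {j} σ≡ with j Finₚ.≟ i
      ... | yes refl = trans (α′-at-i λ σ≡nothing → contradiction (trans (sym σ≡) σ≡nothing) λ ()) (ext σ≡)
      ... | no  j≢i  = trans (cong (_$ _) (α′-elsewhere j≢i)) (ext σ≡)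

      inj′ : InjectiveOn S α′
      inj′ {j} {j′} j∈S j′∈S j≢j′ with j Finₚ.≟ i | j′ Finₚ.≟ i
      ... | yes refl | yes refl  = contradiction refl j≢j′
      ... | yes refl | no  j′≢i  = λ same → proj₂ (proj₂ fresh) (x∈p∧x≢y⇒x∈p-y j′∈S j′≢i) λ ℓ →
        trans (sym (cong (_$ ℓ) (updateAt-updates i α))) (trans (same ℓ) (cong (_$ ℓ) (α′-elsewhere j′≢i)))
      ... | no  j≢i  | yes refl  = λ same → proj₂ (proj₂ fresh) (x∈p∧x≢y⇒x∈p-y j∈S j≢i) λ ℓ →
        trans (sym (cong (_$ ℓ) (updateAt-updates i α))) (trans (sym (same ℓ)) (cong (_$ ℓ) (α′-elsewhere j≢i)))
      ... | no  j≢i  | no  j′≢i  = λ same → inj (x∈p∧x≢y⇒x∈p-y j∈S j≢i) (x∈p∧x≢y⇒x∈p-y j′∈S j′≢i) j≢j′ λ ℓ →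
        trans (sym (cong (_$ ℓ) (α′-elsewhere j≢i))) (trans (same ℓ) (cong (_$ ℓ) (α′-elsewhere j′≢i)))

      back : ∀ {l} → l ∈ C → α′ ⊨ˡ l → l ∈ C × α ⊨ˡ l
      back {(j , ℓ) , b} l∈C α′⊨l with j Finₚ.≟ i
      ... | yes refl = l∈C ,
        trans (sym (α′-at-i λ free → i∉M (∈-mentioned⁺ {σ = σ} {C = C} (lose l∈C (refl , free))))) α′⊨l
      ... | no  j≢i  = l∈C , trans (sym (cong (_$ ℓ) (α′-elsewhere j≢i))) α′⊨l

    entails-prune : ∀ {N S C} → (∀ i → N ≤ 2 ^ length (G i)) → ∣ S ∣ ≤ N →
      Entails S C → Entails (S ∩ mentioned σ C) C
    entails-prune {N} {S} {C} N≤ = prune (suc ∣ S ∣) ≤-refl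
      where
      M = mentioned σ C

      prune : ∀ fuel {S} → ∣ S ∣ < fuel → ∣ S ∣ ≤ N → Entails S C → Entails (S ∩ M) C
      prune (suc fuel) {S} ∣S∣<fuel ∣S∣≤N ⊨C
        with Finₚ.any? (λ i → (i ∈? S) ×-dec ¬? (i ∈? M))
      ... | yes (i , i∈S , i∉M) =
        entails-⊆ S-i∩M⊆S∩M (prune fuel (≤-trans (x∈p⇒∣p-x∣<∣p∣ i∈S) (≤-pred ∣S∣<fuel))
          (≤-trans (<⇒≤ (x∈p⇒∣p-x∣<∣p∣ i∈S)) ∣S∣≤N)
          (entails-remove i∈S i∉M (≤-trans ∣S∣≤N (N≤ i)) ⊨C))
        where
        S-i∩M⊆S∩M : (S - i) ∩ M ⊆ₛ S ∩ M
        S-i∩M⊆S∩M j∈ with j∈S-i , j∈M ← x∈p∩q⁻ (S - i) M j∈ = x∈p∩q⁺ (p─q⊆p S ⁅ i ⁆ j∈S-i , j∈M)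
      ... | no ∄unmentioned = entails-⊆ S⊆S∩M ⊨C
        where
        S⊆S∩M : S ⊆ₛ S ∩ M
        S⊆S∩M {j} j∈S with j ∈? M
        ... | yes j∈M = x∈p∩q⁺ (j∈S , j∈M)
        ... | no  j∉M = contradiction (j , j∈S , j∉M) ∄unmentioned

    module _ (w : ℕ) (2≤w : 2 ≤ w) (2w≤ : ∀ i → 2 * w ≤ 2 ^ length (G i)) where

      EntailedByFew : Clause m k → Set
      EntailedByFew C = ∃[ S ] ∣ S ∣ ≤ w × Entails S C

      Wide⇒⊩ : Clause m k → Set
      Wide⇒⊩ C = w < ∣ mentioned σ C ∣ → σ ⊩ C

      entailedByFew-resolvent : ∀ {C₁ C₂ E} → IsResolvent C₁ C₂ E → Wide⇒⊩ E →
        EntailedByFew C₁ → EntailedByFew C₂ → EntailedByFew E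
      entailedByFew-resolvent {E = E} r wide (S₁ , ∣S₁∣≤w , ⊨C₁) (S₂ , ∣S₂∣≤w , ⊨C₂)
        with ∣ (S₁ ∪ S₂) ∩ mentioned σ E ∣ ≤? w
      ... | yes small = _ , small , entails-prune 2w≤ ∣S₁∪S₂∣≤2w (entails-resolvent r ⊨C₁ ⊨C₂)
        where
        ∣S₁∪S₂∣≤2w : ∣ S₁ ∪ S₂ ∣ ≤ 2 * w
        ∣S₁∪S₂∣≤2w = ≤-trans (∣p∪q∣≤∣p∣+∣q∣ S₁ S₂)
          (≤-trans (+-mono-≤ ∣S₁∣≤w ∣S₂∣≤w) (≤-reflexive (cong (w +_) (sym (+-identityʳ w)))))
      ... | no  large = ∅ , ≤-trans (≤-reflexive (∣⊥∣≡0 m)) z≤n ,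
        ⊩⇒entails (wide (<-≤-trans (≰⇒> large) (∣p∩q∣≤∣q∣ (S₁ ∪ S₂) _)))

      lines-entailedByFew : ∀ {Γ} → Derivation (RestrictedBinPHPClause ρ) Γ →
        (∀ {C} → C ∈ Γ → Wide⇒⊩ C) → ∀ {C} → C ∈ Γ → EntailedByFew C
      lines-entailedByFew (axiom _ ax) _ (here refl) =
        let S , ∣S∣≤2 , ⊨C = entails-axiom ax in S , ≤-trans ∣S∣≤2 2≤w , ⊨C
      lines-entailedByFew (resolve d C₁∈ C₂∈ r) wide (here refl) = entailedByFew-resolvent r (wide (here refl))
        (lines-entailedByFew d (wide ∘ there) C₁∈) (lines-entailedByFew d (wide ∘ there) C₂∈)
      lines-entailedByFew (weaken d C∈ wk) wide (here refl) =
        let S , ∣S∣≤w , ⊨C = lines-entailedByFew d (wide ∘ there) C∈ in S , ∣S∣≤w , entails-weakening wk ⊨C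
      lines-entailedByFew (axiom d _) wide (there C∈) = lines-entailedByFew d (wide ∘ there) C∈
      lines-entailedByFew (resolve d _ _ _) wide (there C∈) = lines-entailedByFew d (wide ∘ there) C∈
      lines-entailedByFew (weaken d _ _) wide (there C∈) = lines-entailedByFew d (wide ∘ there) C∈

      no-refutation : (π : Refutation (RestrictedBinPHPClause ρ)) →
        (∀ {C} → C ∈ Refutation.lines π → Wide⇒⊩ C) → ⊥
      no-refutation π wide
        with S , ∣S∣≤w , ⊨[] ← lines-entailedByFew (Refutation.derivation π) wide (Refutation.contradiction π) =
        ¬entails-[] (λ i∈ → case-[] (∈-mentioned⁻ {σ = σ} {C = []} (proj₂ (x∈p∩q⁻ S _ i∈))))
          (entails-prune 2w≤ (≤-trans ∣S∣≤w (m≤n*m w 2)) ⊨[])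
        where
        case-[] : ∀ {i} → ¬ Any (OnFreeBitOf σ i) []
        case-[] ()

module RandomRestriction {m k} (ρ : PartialAssignment m k) (q : ℕ)
  (2*|freeBits|≡1+q : ∀ i → 2 * length (freeBits ρ i) ≡ suc q) (w : ℕ) where

  options : Fin m → List (Fin k × Bool)
  options i = map (_, true) (freeBits ρ i) ++ map (_, false) (freeBits ρ i)

  length-options : ∀ i → length (options i) ≡ suc q
  length-options i = begin
    length (options i)                                   ≡⟨ length-++ (map (_, true) (freeBits ρ i)) ⟩
    length (map (_, true) (freeBits ρ i)) + length (map (_, false) (freeBits ρ i))
      ≡⟨ cong₂ _+_ (length-map _ (freeBits ρ i)) (trans (length-map _ (freeBits ρ i)) (sym (+-identityʳ _))) ⟩
    2 * length (freeBits ρ i)                            ≡⟨ 2*|freeBits|≡1+q i ⟩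
    suc q                                                ∎
    where open ≡-Reasoning

  ∈-options⁺ : ∀ {i ℓ} b → ρ i ℓ ≡ nothing → (ℓ , b) ∈ options i
  ∈-options⁺ {i} true  free = ∈-++⁺ˡ (∈-map⁺ (_, true) (∈-freeBits⁺ {σ = ρ} free))
  ∈-options⁺ {i} false free = ∈-++⁺ʳ (map (_, true) (freeBits ρ i)) (∈-map⁺ (_, false) (∈-freeBits⁺ {σ = ρ} free))

  ∈-options⁻ : ∀ {i x} → x ∈ options i → ρ i (proj₁ x) ≡ nothing
  ∈-options⁻ {i} x∈ with ∈-++⁻ (map (_, true) (freeBits ρ i)) x∈
  ... | inj₁ x∈ with _ , ℓ∈ , refl ← ∈-map⁻ (_, true) x∈ = ∈-freeBits⁻ {σ = ρ} {i = i} ℓ∈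
  ... | inj₂ x∈ with _ , ℓ∈ , refl ← ∈-map⁻ (_, false) x∈ = ∈-freeBits⁻ {σ = ρ} {i = i} ℓ∈

  Avoids : Clause m k → Fin m → Fin k × Bool → Set
  Avoids C i (ℓ , b) = ((i , ℓ) , b) ∉ C

  avoids? : ∀ C i → Decidable (Avoids C i)
  avoids? C i (ℓ , b) = ¬? (any? (((i , ℓ) , b) ≟ˡ_) C)

  Bad : Clause m k → (Fin m → Fin k × Bool) → Set
  Bad C f = w < ∣ mentioned ρ C ∣ × ¬ (ρ ◃ f) ⊩ C

  bad? : ∀ C → Decidable (Bad C)
  bad? C f = (w <? ∣ mentioned ρ C ∣) ×-dec ¬? ((ρ ◃ f) ⊩? C)

  bad⇒avoids : ∀ {C f} → Bad C f → ∀ i → Avoids C i (f i)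
  bad⇒avoids {C} {f} (_ , ρ◃f⊮C) i l∈C = ρ◃f⊮C (lose l∈C (◃-fixes ρ f i))

  -- a pigeon with a free literal in C has an option satisfying it
  avoiding-options : ∀ C i → length (filter (avoids? C i) (options i)) ≤ weight q (mentioned ρ C) i
  avoiding-options C i with lookup (mentioned ρ C) i in i∈?
  ... | false = ≤-trans (length-filter (avoids? C i) (options i)) (≤-reflexive (length-options i))
  ... | true  with ((j , ℓ) , b) , l∈C , refl , free ← find (∈-mentioned⁻ {σ = ρ} {C = C} (lookup⇒[]= i _ i∈?)) =
    ≤-pred (≤-trans (filter-notAll (avoids? C i) (options i) (lose (∈-options⁺ b free) λ avoids → avoids l∈C))
                    (≤-reflexive (length-options i)))

  bad-count : ∀ C → length (filter (bad? C) (choices options)) * suc q ^ w ≤ q ^ w * suc q ^ m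
  bad-count C = by-width (w <? ∣ mentioned ρ C ∣)
    where
    by-width : Dec (w < ∣ mentioned ρ C ∣) →
      length (filter (bad? C) (choices options)) * suc q ^ w ≤ q ^ w * suc q ^ m
    by-width (no narrow) = ≤-trans (≤-reflexive (cong (λ xs → length xs * suc q ^ w)
      (filter-none (bad? C) {xs = choices options} (All.tabulate λ _ bad → narrow (proj₁ bad))))) z≤n
    by-width (yes wide)  = begin
      length (filter (bad? C) (choices options)) * suc q ^ w
        ≤⟨ *-monoˡ-≤ _ (length-filter-choices (bad? C) (avoids? C) bad⇒avoids options) ⟩
      ∏ (λ i → length (filter (avoids? C i) (options i))) * suc q ^ w
        ≤⟨ *-monoˡ-≤ _ (∏-mono-≤ (avoiding-options C)) ⟩
      ∏ (weight q (mentioned ρ C)) * suc q ^ w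
        ≤⟨ ∏weight*[1+q]^w≤q^w*[1+q]^m q (mentioned ρ C) w (<⇒≤ wide) ⟩
      q ^ w * suc q ^ m ∎
      where open ≤-Reasoning

  few-bad : ∀ (Γ : List (Clause m k)) → length Γ * q ^ w < suc q ^ w →
    sum (map (λ C → length (filter (bad? C) (choices options))) Γ) < length (choices options)
  few-bad Γ |Γ|*q^w< = *-cancelʳ-< (suc q ^ w) Σbad _ (begin-strict
    Σbad * suc q ^ w                 ≤⟨ sum-map-*-≤ bad-count Γ ⟩
    length Γ * (q ^ w * suc q ^ m)   ≡⟨ *-assoc (length Γ) _ _ ⟨
    length Γ * q ^ w * suc q ^ m     <⟨ *-monoˡ-< (suc q ^ m) {{m^n≢0 (suc q) m}} |Γ|*q^w< ⟩
    suc q ^ w * suc q ^ m            ≡⟨ *-comm (suc q ^ w) _ ⟩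
    suc q ^ m * suc q ^ w            ≡⟨ cong (_* suc q ^ w) (∏-const m (suc q)) ⟨
    ∏ {m} (const (suc q)) * suc q ^ w ≤⟨ *-monoˡ-≤ _ (∏-mono-≤ (≤-reflexive ∘ sym ∘ length-options)) ⟩
    ∏ (length ∘ options) * suc q ^ w ≡⟨ cong (_* suc q ^ w) (length-choices options) ⟨
    length (choices options) * suc q ^ w ∎)
    where
    open ≤-Reasoning
    Σbad = sum (map (λ C → length (filter (bad? C) (choices options))) Γ)

  random-restriction : ∀ (Γ : List (Clause m k)) → length Γ * q ^ w < suc q ^ w →
    ∃[ f ] (∀ i → ρ i (proj₁ (f i)) ≡ nothing) × (∀ {C} → C ∈ Γ → w < ∣ mentioned ρ C ∣ → (ρ ◃ f) ⊩ C)
  random-restriction Γ |Γ|*q^w< with f , f∈ , good ← union-bound bad? Γ (choices options) (few-bad Γ |Γ|*q^w<) =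
    f , (λ i → ∈-options⁻ (∈-choices⁻ options f∈ i)) ,
    λ {C} C∈Γ wide → decidable-stable ((ρ ◃ f) ⊩? C) (λ ρ◃f⊮C → All.lookup good C∈Γ (wide , ρ◃f⊮C))

2≤size : ∀ {m k} {Ax : Axioms m k} → ¬ Ax [] → (π : Refutation Ax) → 2 ≤ size π
2≤size {Ax = Ax} []∉Ax π = two-lines (Refutation.derivation π) (Refutation.contradiction π)
  where
  two-lines : ∀ {Γ} → Derivation Ax Γ → [] ∈ Γ → 2 ≤ length Γ
  two-lines (axiom empty ax)     (here refl) = contradiction ax []∉Ax
  two-lines (resolve empty () _ _) _
  two-lines (weaken empty () _)    _
  two-lines {_ ∷ _ ∷ _} _ _ = s≤s (s≤s z≤n)

[]∉RestrictedBinPHPClause : ∀ {m k} {ρ : PartialAssignment m k} → (∀ i → ∃[ ℓ ] ρ i ℓ ≡ nothing) →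
  ¬ RestrictedBinPHPClause ρ []
[]∉RestrictedBinPHPClause free (i , _ , a , _ , _ , []⇔)
  with ℓ , ρ≡nothing ← free i
  with () ← Equivalence.from ([]⇔ _) (∈-++⁺ˡ (∈-map⁺ _ (∈-allFin ℓ)) , ρ≡nothing)

restricted-width-lower-bound : ∀ {m k} u′ (ρ : PartialAssignment m k) → (∀ i → length (freeBits ρ i) ≡ 3 + u′) →
  (f : Fin m → Fin k × Bool) → (∀ i → ρ i (proj₁ (f i)) ≡ nothing) → (π : Refutation (RestrictedBinPHPClause ρ)) →
  (∀ {C} → C ∈ Refutation.lines π → 2 ^ suc u′ < ∣ mentioned ρ C ∣ → (ρ ◃ f) ⊩ C) → ⊥
restricted-width-lower-bound {m} {k} u′ ρ |freeBits|≡ f f-free π kills =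
  Entailment.no-refutation ρ⊑ρ◃f G G-unique G-free w 2≤w 2w≤ π
    λ {C} C∈ wide → kills C∈ (<-≤-trans wide (p⊆q⇒∣p∣≤∣q∣ (mentioned-⊑ {ρ = ρ} {σ = ρ ◃ f} C ρ⊑ρ◃f)))
  where
  w = 2 ^ suc u′

  ρ⊑ρ◃f : ρ ⊑ (ρ ◃ f)
  ρ⊑ρ◃f = ⊑-◃ {ρ = ρ} {f = f} f-free

  G : Fin m → List (Fin k)
  G i = filter (λ ℓ → ¬? (ℓ Finₚ.≟ proj₁ (f i))) (freeBits ρ i)

  G-unique : ∀ i → Unique (G i)
  G-unique i = filter⁺ _ (freeBits-unique ρ i)

  G-free : ∀ {i ℓ} → ℓ ∈ G i → (ρ ◃ f) i ℓ ≡ nothing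
  G-free {i} ℓ∈ with ℓ∈free , ℓ≢ ← ∈-filter⁻ (λ ℓ → ¬? (ℓ Finₚ.≟ proj₁ (f i))) {xs = freeBits ρ i} ℓ∈ =
    ◃-free {ρ = ρ} {f = f} ℓ≢ (∈-freeBits⁻ {σ = ρ} ℓ∈free)

  2≤w : 2 ≤ w
  2≤w = *-monoʳ-≤ 2 (m^n>0 2 u′)

  2w≤ : ∀ i → 2 * w ≤ 2 ^ length (G i)
  2w≤ i = ^-monoʳ-≤ 2 (≤-pred (≤-trans (≤-reflexive (sym (|freeBits|≡ i)))
                                 (length≤1+length-filter-≢ Finₚ._≟_ (freeBits-unique ρ i))))

-- With u = 3 + u′ free bits per pigeon there are q + 1 = 2 u ways to fix one more bit, and the
-- width threshold w = 2 ^ (u − 2) is chosen so that 2 w holes exist on the remaining u − 1 free bits.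
size-lower-bound : ∀ {m k} u′ (ρ : PartialAssignment m k) → (∀ i → length (freeBits ρ i) ≡ 3 + u′) →
  (π : Refutation (RestrictedBinPHPClause ρ)) →
  ¬ (size π * suc (2 * (2 + u′)) ^ 2 ^ suc u′ < suc (suc (2 * (2 + u′))) ^ 2 ^ suc u′)
size-lower-bound u′ ρ |freeBits|≡ π small =
  let f , f-free , kills = RandomRestriction.random-restriction ρ _ 2*|freeBits|≡1+q _ (Refutation.lines π) small
  in restricted-width-lower-bound u′ ρ |freeBits|≡ f f-free π kills
  where
  2*|freeBits|≡1+q : ∀ i → 2 * length (freeBits ρ i) ≡ suc (suc (2 * (2 + u′)))
  2*|freeBits|≡1+q i = trans (cong (2 *_) (|freeBits|≡ i)) (lemma u′)
    where
    lemma : ∀ u → 2 * (3 + u) ≡ 2 + 2 * (2 + u)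
    lemma = solve-∀

exponent-identity : ∀ t u′ →
  2 ^ suc u′ * (4 ^ 2 * 2 ^ t * (3 + u′)) ≡ suc (suc (2 * (2 + u′))) * (2 * 2 ^ (t + (3 + u′)))
exponent-identity t u′ rewrite ^-distribˡ-+-* 2 t (3 + u′) = lemma (2 ^ t) (2 ^ u′) u′
  where
  lemma : ∀ x y u → 2 * y * (16 * x * (3 + u)) ≡ (2 + 2 * (2 + u)) * (2 * (x * (2 * (2 * (2 * y)))))
  lemma = solve-∀

narrow-exponent : ∀ t u → 1 ≤ u → u ≤ 2 → 2 * 2 ^ (t + u) ≤ 4 ^ 2 * 2 ^ t * u
narrow-exponent t u 1≤u u≤2 = begin
  2 * 2 ^ (t + u)     ≡⟨ cong (2 *_) (^-distribˡ-+-* 2 t u) ⟩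
  2 * (2 ^ t * 2 ^ u) ≡⟨ x∙yz≈y∙xz 2 (2 ^ t) (2 ^ u) ⟩
  2 ^ t * (2 * 2 ^ u) ≤⟨ *-monoʳ-≤ (2 ^ t) (2*2^u≤16*u u 1≤u u≤2) ⟩
  2 ^ t * (16 * u)    ≡⟨ x∙yz≈y∙xz (2 ^ t) 16 u ⟩
  16 * (2 ^ t * u)    ≡⟨ *-assoc 16 (2 ^ t) u ⟨
  4 ^ 2 * 2 ^ t * u   ∎
  where
  open ≤-Reasoning
  2*2^u≤16*u : ∀ u → 1 ≤ u → u ≤ 2 → 2 * 2 ^ u ≤ 16 * u
  2*2^u≤16*u 1 _ _ = m≤m+n 4 12
  2*2^u≤16*u 2 _ _ = m≤m+n 8 24
  2*2^u≤16*u (suc (suc (suc _))) _ (s≤s (s≤s ()))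

narrow-lower-bound : ∀ {m k t} u → 1 ≤ u → u ≤ 2 → t + u ≡ k → (ρ : PartialAssignment m k) →
  IsTBitRestriction t ρ → (π : Refutation (RestrictedBinPHPClause ρ)) →
  ¬ (size π <exp[ 2 ^ k / (4 ^ 2 * 2 ^ t * u) ])
narrow-lower-bound {t = t} u 1≤u u≤2 refl ρ t-bit π =
  2≤S⇒2a≤b⇒¬S<exp[a/b] (2≤size ([]∉RestrictedBinPHPClause has-free-bit) π) (narrow-exponent t u 1≤u u≤2)
  where
  has-free-bit : ∀ i → ∃[ ℓ ] ρ i ℓ ≡ nothing
  has-free-bit i with freeBits ρ i in free≡ | trans (length-freeBits t-bit i) (m+n∸m≡n t u)
  ... | ℓ ∷ _ | _ = ℓ , ∈-freeBits⁻ {σ = ρ} (subst (ℓ ∈_) (sym free≡) (here refl))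
  has-free-bit i | [] | 0≡u = contradiction (sym 0≡u) (m<n⇒n≢0 1≤u)

wide-lower-bound : ∀ {m k t} u′ → t + (3 + u′) ≡ k → (ρ : PartialAssignment m k) →
  IsTBitRestriction t ρ → (π : Refutation (RestrictedBinPHPClause ρ)) →
  ¬ (size π <exp[ 2 ^ k / (4 ^ 2 * 2 ^ t * (3 + u′)) ])
wide-lower-bound {t = t} u′ refl ρ t-bit π S<exp =
  size-lower-bound u′ ρ (λ i → trans (length-freeBits t-bit i) (m+n∸m≡n t (3 + u′))) π
    (<exp⇒S*q^w<[1+q]^w (suc (2 * (2 + u′))) (2 ^ suc u′) (exponent-identity t u′) S<exp)

corollary4p5 : ∀ (m k t : ℕ) → 2 ^ k < m → t < k →
    ∀ (ρ : PartialAssignment m k) → IsTBitRestriction t ρ →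
    ∀ (π : Refutation (RestrictedBinPHPClause ρ)) →
    ¬ (size π <exp[ 2 ^ k / (4 ^ 2 * 2 ^ t * (k ∸ t)) ])
-- The argument does not need 2 ^ k < m.
corollary4p5 m k t _ t<k ρ t-bit π with k ∸ t | m+[n∸m]≡n (<⇒≤ t<k) | m<n⇒0<n∸m t<k
... | 0                  | _     | ()
... | 1                  | t+1≡k | _ = narrow-lower-bound 1 ≤-refl (s≤s z≤n) t+1≡k ρ t-bit π
... | 2                  | t+2≡k | _ = narrow-lower-bound 2 (s≤s z≤n) ≤-refl t+2≡k ρ t-bit π
... | suc (suc (suc u′)) | t+u≡k | _ = wide-lower-bound u′ t+u≡k ρ t-bit π
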